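{- A general map $\mathcal M=(B,\sigma,\alpha)$ has a single component (i.e. is a map) if and only if $\mathcal M$ has a quasi-tree.
   Context: A general map is a triple $\mathcal M=(B,\sigma,\alpha)$ where $B$ is a finite set (of flags), $\sigma,\alpha$ are permutations of $B$ and $\alpha$ is a fixed-point-free involution; permutations compose as functions. Its components are the orbits of the group $\langle\sigma,\alpha\rangle$; $\mathcal M$ is a map if $\langle\sigma,\alpha\rangle$ acts transitively on $B$. The edges of $\mathcal M$ are the cycles of $\alpha$ (two-element sets); for a flag $b$, $\underline b=\{b,\alpha(b)\}$. For a set $F$ of edges, the tour of $F$ in $\mathcal M$ is the permutation $\tau$ of $B$ with $\tau(b)=\sigma\alpha(b)$ if $\underline b\in F$ and $\tau(b)=\sigma(b)$ otherwise. A quasi-tree of $\mathcal M$ is a set $F$ of edges whose tour is a single cycle on $B$ (a cyclic permutation of $B$). -}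

module Defs where

open import Data.Nat using (ℕ; zero; suc)
open import Data.Fin using (Fin)
open import Data.Fin.Permutation using (Permutation′; _⟨$⟩ʳ_; _⟨$⟩ˡ_)
open import Data.Bool using (Bool; if_then_else_)
open import Data.Product using (∃; _×_)
open import Relation.Binary.PropositionalEquality using (_≡_; _≢_)

record GeneralMap (n : ℕ) : Set where
  field
    σ : Permutation′ n
    α : Permutation′ n
    α-involution : ∀ b → α ⟨$⟩ʳ (α ⟨$⟩ʳ b) ≡ b
    α-fixedPointFree : ∀ b → α ⟨$⟩ʳ b ≢ b

module _ {n : ℕ} (M : GeneralMap n) where
  open GeneralMap M

  data SameOrbit : Fin n → Fin n → Set where
    here    : ∀ {b} → SameOrbit b b
    step-σ  : ∀ {b c} → SameOrbit b c → SameOrbit b (σ ⟨$⟩ʳ c)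
    step-σ⁻ : ∀ {b c} → SameOrbit b c → SameOrbit b (σ ⟨$⟩ˡ c)
    step-α  : ∀ {b c} → SameOrbit b c → SameOrbit b (α ⟨$⟩ʳ c)
    step-α⁻ : ∀ {b c} → SameOrbit b c → SameOrbit b (α ⟨$⟩ˡ c)

  IsMap : Set
  IsMap = ∀ b c → SameOrbit b c

  -- A set F of edges (cycles of α) is encoded as its set of flags,
  -- i.e. a predicate on flags that is invariant under α
  -- (b is in an edge of F iff the edge {b, α b} belongs to F).
  record EdgeSet : Set where
    field
      mem : Fin n → Bool
      mem-α : ∀ b → mem (α ⟨$⟩ʳ b) ≡ mem b

  tour : EdgeSet → Fin n → Fin n
  tour F b = if EdgeSet.mem F b then σ ⟨$⟩ʳ (α ⟨$⟩ʳ b) else σ ⟨$⟩ʳ b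

iter : {A : Set} → (A → A) → ℕ → A → A
iter f zero    x = x
iter f (suc k) x = f (iter f k x)

IsCyclic : {n : ℕ} → (Fin n → Fin n) → Set
IsCyclic {n} τ = ∀ (b c : Fin n) → ∃ λ k → iter τ k b ≡ c

module _ {n : ℕ} (M : GeneralMap n) where
  IsQuasiTree : EdgeSet M → Set
  IsQuasiTree F = IsCyclic (tour M F)

  HasQuasiTree : Set
  HasQuasiTree = ∃ λ (F : EdgeSet M) → IsQuasiTree F

{-# OPTIONS --safe #-}
-- A quasi-tree's tour moves each flag by σ or σα, so it never leaves a component;
-- being a single cycle, it makes ⟨σ, α⟩ transitive. Conversely, fix a flag x and an
-- edge set F. If the tour-cycle of x is closed under α it is closed under σ as well
-- (σ c is the tour image of c or of α c), hence by transitivity it is all of B and F is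
-- a quasi-tree. Otherwise some b on the cycle has α b off it; toggling the edge {b, α b}
-- composes the tour with the transposition (b α b), which merges the two cycles, so the
-- cycle of x strictly grows. After at most |B| toggles a quasi-tree is reached.
module Submission where

open import Data.Bool using (Bool; true; false; if_then_else_; _∨_; _xor_)
open import Data.Bool.Properties using (∨-comm)
open import Data.Fin using (Fin; zero; toℕ; fromℕ<)
open import Data.Fin.Permutation using (Permutation′; _⟨$⟩ʳ_; inverseʳ)
open import Data.Fin.Properties using (_≟_; any?; pigeonhole; toℕ-fromℕ<)
open import Data.Fin.Subset using (Subset; _∈_; _⊂_; ∣_∣)
open import Data.Fin.Subset.Properties using (∣p∣≤n; p⊂q⇒∣p∣<∣q∣)
open import Data.Nat using (ℕ; zero; suc; _+_; _*_; _∸_; _≤_; _<_)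
open import Data.Nat.DivMod using (_%_; _/_; m≡m%n+[m/n]*n; m%n<n)
open import Data.Nat.Properties
  using (n<1+n; +-comm; +-suc; m+[n∸m]≡n; m≤m+n; ≤-trans; ≤-reflexive; +-monoʳ-≤; <⇒≱)
open import Data.Product using (∃; _×_; _,_; proj₁; proj₂)
open import Data.Sum using (_⊎_; inj₁; inj₂; [_,_]′)
open import Data.Vec using (tabulate)
open import Data.Vec.Properties using (lookup⇒[]=; []=⇒lookup; lookup∘tabulate)
open import Function using (id; _∘_)
open import Function.Bundles using (Injection)
open import Function.Definitions using (Injective)
open import Function.Properties.Inverse using (↔⇒↣)
open import Relation.Nullary using (Dec; yes; no; ¬_; does)
open import Relation.Nullary.Decidable using (map′; dec-true; dec-false; decidable-stable; _×-dec_; ¬?)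
open import Relation.Nullary.Negation using (contradiction)
open import Relation.Binary.PropositionalEquality

open import Defs

Reach : ∀ {n} → (Fin n → Fin n) → Fin n → Fin n → Set
Reach f x y = ∃ λ k → iter f k x ≡ y

module Reachability {n : ℕ} (f : Fin n → Fin n) where

  infix 4 _↝_
  _↝_ : Fin n → Fin n → Set
  _↝_ = Reach f

  iter-+ : ∀ j k x → iter f (j + k) x ≡ iter f j (iter f k x)
  iter-+ zero    k x = refl
  iter-+ (suc j) k x = cong f (iter-+ j k x)

  iter-sucʳ : ∀ k x → iter f (suc k) x ≡ iter f k (f x)
  iter-sucʳ k x = trans (cong (λ m → iter f m x) (+-comm 1 k)) (iter-+ k 1 x)

  iter-periodic : ∀ {p x} → iter f p x ≡ x → ∀ m → iter f (m * p) x ≡ x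
  iter-periodic         e zero    = refl
  iter-periodic {p} {x} e (suc m) = trans (iter-+ p (m * p) x) (trans (cong (iter f p) (iter-periodic e m)) e)

  ↝-refl : ∀ {x} → x ↝ x
  ↝-refl = 0 , refl

  ↝-step : ∀ {x y} → x ↝ y → x ↝ f y
  ↝-step (k , e) = suc k , cong f e

  ↝-trans : ∀ {x y z} → x ↝ y → y ↝ z → x ↝ z
  ↝-trans {x} (j , refl) (k , e) = k + j , trans (iter-+ k j x) e

  ↝-closed-until : ∀ (P : Fin n → Set) {x y} → (∀ {c} → x ↝ c → c ≢ y → P c → P (f c)) →
                   P x → x ↝ y → P y
  ↝-closed-until P {x} {y} step px (k , e) = [ id , subst P e ]′ (walk k)
    where
    walk : ∀ j → P y ⊎ P (iter f j x)
    walk zero = inj₂ px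
    walk (suc j) with walk j
    ... | inj₁ py = inj₁ py
    ... | inj₂ pj with iter f j x ≟ y
    ...   | yes eq = inj₁ (subst P eq pj)
    ...   | no neq = inj₂ (step (j , refl) neq pj)

  ↝-closed : ∀ (P : Fin n → Set) {x y} → (∀ {c} → P c → P (f c)) → P x → x ↝ y → P y
  ↝-closed P step = ↝-closed-until P (λ _ _ → step)

module InjectiveOrbits {n : ℕ} {f : Fin n → Fin n} (f-injective : Injective _≡_ _≡_ f) where

  open Reachability f public

  period : ∀ x → ∃ λ p → iter f (suc p) x ≡ x
  period x with pigeonhole (n<1+n n) (λ i → iter f (toℕ i) x)
  ... | i , j , i<j , e = toℕ j ∸ suc (toℕ i) , sym (cancel (toℕ i) (trans e (cong (λ m → iter f m x) (sym j≡))))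
    where
    j≡ : toℕ i + suc (toℕ j ∸ suc (toℕ i)) ≡ toℕ j
    j≡ = trans (+-suc (toℕ i) _) (m+[n∸m]≡n i<j)
    cancel : ∀ l {k} → iter f l x ≡ iter f (l + k) x → x ≡ iter f k x
    cancel zero    e = e
    cancel (suc l) e = cancel l (f-injective e)

  iter-mod-period : ∀ {p x} → iter f (suc p) x ≡ x → ∀ k → iter f k x ≡ iter f (k % suc p) x
  iter-mod-period {p} {x} e k = begin
    iter f k x                                   ≡⟨ cong (λ m → iter f m x) (m≡m%n+[m/n]*n k (suc p)) ⟩
    iter f (k % suc p + k / suc p * suc p) x     ≡⟨ iter-+ (k % suc p) _ x ⟩
    iter f (k % suc p) (iter f (k / suc p * suc p) x) ≡⟨ cong (iter f (k % suc p)) (iter-periodic e (k / suc p)) ⟩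
    iter f (k % suc p) x                         ∎
    where open ≡-Reasoning

  image-↝ : ∀ {x} → f x ↝ x
  image-↝ {x} with period x
  ... | p , e = p , trans (sym (iter-sucʳ p x)) e

  ↝-sym : ∀ {x y} → x ↝ y → y ↝ x
  ↝-sym (zero  , refl) = ↝-refl
  ↝-sym (suc k , refl) = ↝-trans image-↝ (↝-sym (k , refl))

  infix 4 _↝?_
  _↝?_ : ∀ x y → Dec (x ↝ y)
  x ↝? y with period x
  ... | p , e = map′ (λ (i , eq) → toℕ i , eq) reduce (any? λ (i : Fin (suc p)) → iter f (toℕ i) x ≟ y)
    where
    reduce : x ↝ y → ∃ λ (i : Fin (suc p)) → iter f (toℕ i) x ≡ y
    reduce (k , eq) = fromℕ< (m%n<n k (suc p)) ,
      trans (cong (λ m → iter f m x) (toℕ-fromℕ< (m%n<n k (suc p)))) (trans (sym (iter-mod-period e k)) eq)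

  closed-under-preimage : ∀ (P : Fin n → Set) → (∀ {c} → P c → P (f c)) → ∀ {x} → P (f x) → P x
  closed-under-preimage P step pfx = ↝-closed P step pfx image-↝

  -- g is f composed with the transposition of b and b′; the cycle of b absorbs the one of b′.
  transposition-merges : ∀ (g : Fin n → Fin n) {x b b′} →
    (∀ {c} → c ≢ b → c ≢ b′ → g c ≡ f c) → g b ≡ f b′ → g b′ ≡ f b →
    x ↝ b → ¬ x ↝ b′ → (∀ {c} → x ↝ c → Reach g x c) × Reach g x b′
  transposition-merges g {x} {b} {b′} agree gb gb′ x↝b x↝̸b′ = ↝-closed (Reach g x) f-step G.↝-refl , x⇝b′
    where
    module G = Reachability g

    x⇝b : Reach g x b
    x⇝b = ↝-closed-until (Reach g x) step G.↝-refl x↝b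
      where
      step : ∀ {c} → x ↝ c → c ≢ b → Reach g x c → Reach g x (f c)
      step x↝c c≢b r = subst (Reach g x) (agree c≢b (λ { refl → x↝̸b′ x↝c })) (G.↝-step r)

    x⇝b′ : Reach g x b′
    x⇝b′ = ↝-closed-until (Reach g x) step (subst (Reach g x) gb (G.↝-step x⇝b)) image-↝
      where
      step : ∀ {c} → f b′ ↝ c → c ≢ b′ → Reach g x c → Reach g x (f c)
      step {c} fb′↝c c≢b′ r = subst (Reach g x) (agree c≢b c≢b′) (G.↝-step r)
        where
        c≢b : c ≢ b
        c≢b refl = x↝̸b′ (↝-trans x↝b (↝-sym (↝-trans (↝-step ↝-refl) fb′↝c)))

    f-step : ∀ {c} → Reach g x c → Reach g x (f c)
    f-step {c} r with c ≟ b | c ≟ b′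
    ... | yes refl | _        = subst (Reach g x) gb′ (G.↝-step x⇝b′)
    ... | no _     | yes refl = subst (Reach g x) gb (G.↝-step x⇝b)
    ... | no c≢b   | no c≢b′  = subst (Reach g x) (agree c≢b c≢b′) (G.↝-step r)

toSubset : ∀ {n} {P : Fin n → Set} → (∀ x → Dec (P x)) → Subset n
toSubset P? = tabulate (does ∘ P?)

module _ {n} {P : Fin n → Set} (P? : ∀ x → Dec (P x)) where

  ∈-toSubset⁺ : ∀ {x} → P x → x ∈ toSubset P?
  ∈-toSubset⁺ {x} px = lookup⇒[]= x _ (trans (lookup∘tabulate _ x) (dec-true (P? x) px))

  ∈-toSubset⁻ : ∀ {x} → x ∈ toSubset P? → P x
  ∈-toSubset⁻ {x} x∈ with P? x | trans (sym (lookup∘tabulate (does ∘ P?) x)) ([]=⇒lookup x∈)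
  ... | yes px | _ = px
  ... | no _   | ()

toSubset-⊂ : ∀ {n} {P Q : Fin n → Set} (P? : ∀ x → Dec (P x)) (Q? : ∀ x → Dec (Q x)) →
             (∀ {x} → P x → Q x) → ∀ {x} → Q x → ¬ P x → toSubset P? ⊂ toSubset Q?
toSubset-⊂ P? Q? P⊆Q {x} qx ¬px =
  ∈-toSubset⁺ Q? ∘ P⊆Q ∘ ∈-toSubset⁻ P? , x , ∈-toSubset⁺ Q? qx , ¬px ∘ ∈-toSubset⁻ P?

bounded-ascent : ∀ {A : Set} {P : A → Set} {m} (μ : A → ℕ) → (∀ a → μ a ≤ m) →
                 (∀ a → P a ⊎ ∃ λ b → μ a < μ b) → A → ∃ P
bounded-ascent {P = P} {m} μ μ≤m ascend a = climb m a (m≤m+n m (μ a))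
  where
  climb : ∀ k a → m ≤ k + μ a → ∃ P
  climb k a m≤ with ascend a
  ... | inj₁ pa = a , pa
  climb zero    a m≤ | inj₂ (b , a<b) = contradiction (≤-trans (μ≤m b) m≤) (<⇒≱ a<b)
  climb (suc k) a m≤ | inj₂ (b , a<b) =
    climb k b (≤-trans m≤ (≤-trans (≤-reflexive (sym (+-suc k (μ a)))) (+-monoʳ-≤ k a<b)))

permutation-injective : ∀ {n} (π : Permutation′ n) → Injective _≡_ _≡_ (π ⟨$⟩ʳ_)
permutation-injective π = Injection.injective (↔⇒↣ π)

module _ {n : ℕ} (M : GeneralMap n) where
  open GeneralMap M
  open EdgeSet

  SameOrbit-closed : ∀ (P : Fin n → Set) → (∀ {c} → P c → P (σ ⟨$⟩ʳ c)) → (∀ {c} → P c → P (α ⟨$⟩ʳ c)) →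
                     ∀ {b c} → P b → SameOrbit M b c → P c
  SameOrbit-closed P σ-step α-step {b} pb = go
    where
    go : ∀ {c} → SameOrbit M b c → P c
    go here        = pb
    go (step-σ o)  = σ-step (go o)
    go (step-σ⁻ o) = InjectiveOrbits.closed-under-preimage (permutation-injective σ) P σ-step
                       (subst P (sym (inverseʳ σ)) (go o))
    go (step-α o)  = α-step (go o)
    go (step-α⁻ o) = InjectiveOrbits.closed-under-preimage (permutation-injective α) P α-step
                       (subst P (sym (inverseʳ α)) (go o))

  α[_] : EdgeSet M → Fin n → Fin n
  α[ F ] c = if mem F c then α ⟨$⟩ʳ c else c

  tour-α[] : ∀ F c → tour M F c ≡ σ ⟨$⟩ʳ (α[ F ] c)
  tour-α[] F c with mem F c
  ... | true  = refl
  ... | false = refl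

  α[]-involutive : ∀ F c → α[ F ] (α[ F ] c) ≡ c
  α[]-involutive F c with mem F c in eq
  ... | false rewrite eq = refl
  ... | true  rewrite mem-α F c | eq = α-involution c

  α[]-closed : ∀ F (P : Fin n → Set) → (∀ {c} → P c → P (α ⟨$⟩ʳ c)) → ∀ {c} → P c → P (α[ F ] c)
  α[]-closed F P α-step {c} pc with mem F c
  ... | true  = α-step pc
  ... | false = pc

  σ-via-tour : ∀ F c → σ ⟨$⟩ʳ c ≡ tour M F (α[ F ] c)
  σ-via-tour F c = trans (cong (σ ⟨$⟩ʳ_) (sym (α[]-involutive F c))) (sym (tour-α[] F (α[ F ] c)))

  tour-injective : ∀ F → Injective _≡_ _≡_ (tour M F)
  tour-injective F {a} {b} e = begin
    a                 ≡⟨ sym (α[]-involutive F a) ⟩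
    α[ F ] (α[ F ] a) ≡⟨ cong α[ F ] (permutation-injective σ (trans (sym (tour-α[] F a)) (trans e (tour-α[] F b)))) ⟩
    α[ F ] (α[ F ] b) ≡⟨ α[]-involutive F b ⟩
    b                 ∎
    where open ≡-Reasoning

  sameEdge : Fin n → Fin n → Bool
  sameEdge b c = does (c ≟ b) ∨ does (α ⟨$⟩ʳ c ≟ b)

  sameEdge-α : ∀ b c → sameEdge b (α ⟨$⟩ʳ c) ≡ sameEdge b c
  sameEdge-α b c rewrite α-involution c = ∨-comm (does (α ⟨$⟩ʳ c ≟ b)) (does (c ≟ b))

  sameEdge-self : ∀ b → sameEdge b b ≡ true
  sameEdge-self b = cong (_∨ does (α ⟨$⟩ʳ b ≟ b)) (dec-true (b ≟ b) refl)

  sameEdge-≢ : ∀ {b c} → c ≢ b → c ≢ α ⟨$⟩ʳ b → sameEdge b c ≡ false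
  sameEdge-≢ {b} {c} c≢b c≢αb = cong₂ _∨_ (dec-false (c ≟ b) c≢b) (dec-false (α ⟨$⟩ʳ c ≟ b) αc≢b)
    where
    αc≢b : α ⟨$⟩ʳ c ≢ b
    αc≢b αc≡b = c≢αb (trans (sym (α-involution c)) (cong (α ⟨$⟩ʳ_) αc≡b))

  toggle : EdgeSet M → Fin n → EdgeSet M
  toggle F b = record
    { mem   = λ c → mem F c xor sameEdge b c
    ; mem-α = λ c → cong₂ _xor_ (mem-α F c) (sameEdge-α b c)
    }

  tour-toggle-off : ∀ F b c → sameEdge b c ≡ false → tour M (toggle F b) c ≡ tour M F c
  tour-toggle-off F b c e rewrite e with mem F c
  ... | true  = refl
  ... | false = refl

  tour-toggle-on : ∀ F b c → sameEdge b c ≡ true → tour M (toggle F b) c ≡ tour M F (α ⟨$⟩ʳ c)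
  tour-toggle-on F b c e rewrite e | mem-α F c | α-involution c with mem F c
  ... | true  = refl
  ... | false = refl

  reached : Fin n → EdgeSet M → Subset n
  reached x F = toSubset (InjectiveOrbits._↝?_ (tour-injective F) x)

  module _ (F : EdgeSet M) where
    open InjectiveOrbits (tour-injective F)

    quasiTree-of-α-closed : IsMap M → ∀ x → (∀ {c} → x ↝ c → x ↝ α ⟨$⟩ʳ c) → IsQuasiTree M F
    quasiTree-of-α-closed isMap x α-step b c = ↝-trans (↝-sym (x↝ b)) (x↝ c)
      where
      σ-step : ∀ {c} → x ↝ c → x ↝ σ ⟨$⟩ʳ c
      σ-step {c} r = subst (x ↝_) (sym (σ-via-tour F c)) (↝-step (α[]-closed F (x ↝_) α-step r))
      x↝ : ∀ c → x ↝ c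
      x↝ c = SameOrbit-closed (x ↝_) σ-step α-step ↝-refl (isMap x c)

    -- Toggling an edge that leaves the cycle of x merges another cycle into it.
    quasiTree-or-larger : IsMap M → ∀ x → IsQuasiTree M F ⊎ ∃ λ F′ → ∣ reached x F ∣ < ∣ reached x F′ ∣
    quasiTree-or-larger isMap x with any? (λ c → (x ↝? c) ×-dec ¬? (x ↝? α ⟨$⟩ʳ c))
    ... | no no-exit = inj₁ (quasiTree-of-α-closed isMap x α-step)
      where
      α-step : ∀ {c} → x ↝ c → x ↝ α ⟨$⟩ʳ c
      α-step {c} r = decidable-stable (x ↝? α ⟨$⟩ʳ c) (λ x↝̸αc → no-exit (c , r , x↝̸αc))
    ... | yes (b , x↝b , x↝̸αb) =
      inj₂ (F′ , p⊂q⇒∣p∣<∣q∣ (toSubset-⊂ (x ↝?_) (InjectiveOrbits._↝?_ (tour-injective F′) x)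
                                          (proj₁ merged) (proj₂ merged) x↝̸αb))
      where
      F′ : EdgeSet M
      F′ = toggle F b
      merged : (∀ {c} → x ↝ c → Reach (tour M F′) x c) × Reach (tour M F′) x (α ⟨$⟩ʳ b)
      merged = transposition-merges (tour M F′)
        (λ c≢b c≢αb → tour-toggle-off F b _ (sameEdge-≢ c≢b c≢αb))
        (tour-toggle-on F b b (sameEdge-self b))
        (trans (tour-toggle-on F b (α ⟨$⟩ʳ b) (trans (sameEdge-α b b) (sameEdge-self b)))
               (cong (tour M F) (α-involution b)))
        x↝b x↝̸αb

emptyEdgeSet : ∀ {n} (M : GeneralMap n) → EdgeSet M
emptyEdgeSet M = record { mem = λ _ → false ; mem-α = λ _ → refl }

map⇒quasiTree : ∀ {n} (M : GeneralMap n) → IsMap M → HasQuasiTree M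
map⇒quasiTree {zero}  M _     = emptyEdgeSet M , λ ()
map⇒quasiTree {suc n} M isMap =
  bounded-ascent (λ F → ∣ reached M zero F ∣) (λ F → ∣p∣≤n (reached M zero F))
                 (λ F → quasiTree-or-larger M F isMap zero) (emptyEdgeSet M)

quasiTree⇒map : ∀ {n} (M : GeneralMap n) → HasQuasiTree M → IsMap M
quasiTree⇒map M (F , cyclic) b c = Reachability.↝-closed (tour M F) (SameOrbit M b) tour-step here (cyclic b c)
  where
  tour-step : ∀ {c} → SameOrbit M b c → SameOrbit M b (tour M F c)
  tour-step {c} o with EdgeSet.mem F c
  ... | true  = step-σ (step-α o)
  ... | false = step-σ o

lemma2 : ∀ {n : ℕ} (M : GeneralMap n) → (IsMap M → HasQuasiTree M) × (HasQuasiTree M → IsMap M)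
lemma2 M = map⇒quasiTree M , quasiTree⇒map M
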